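{- Let $\mathcal{M}=((W,R,V),w_d)$ be a pointed model, let $k \geq 0$ and let $<$ be a total order on $W$. Then the $k$-contraction $\mathcal{M}'=((W',R',V'),w'_d)$ of $\mathcal{M}$ with respect to $<$ is a minimal pointed model $k$-bisimilar to $\mathcal{M}$, both world and edge minimal: for every pointed model $((W'',R'',V''),w''_d)$ that is $k$-bisimilar to $\mathcal{M}$, we have $|W'|\le|W''|$ and $|R'_i|\le|R''_i|$ for every $i\in\mathcal{I}$.
   Context: Fix a countable set $\mathcal{P}$ of atomic propositions and a finite set $\mathcal{I}$ of modality indices. A model is $M=(W,R,V)$ with $W$ finite nonempty, $R_i\subseteq W\times W$ for $i\in\mathcal{I}$, $V:\mathcal{P}\to2^W$; a pointed model is $(M,w_d)$ with $w_d\in W$. For $k\ge0$, a $k$-bisimulation between $(M,w_d)$ and $(M',w'_d)$ is a sequence of nonempty relations $Z_k\subseteq\cdots\subseteq Z_0\subseteq W\times W'$ with $(w_d,w'_d)\in Z_k$ such that pairs in $Z_0$ agree on all atoms, and for all $h<k$: if $(w,w')\in Z_{h+1}$ and $wR_iv$ then some $v'$ has $w'R'_iv'$, $(v,v')\in Z_h$ (forth), and symmetrically (back); $k$-bisimilar means such a sequence exists. For worlds of one model, $w\sim_hv$ means $(M,w),(M,v)$ are $h$-bisimilar; $[w]_h=\{v\in W\mid w\sim_hv\}$. With respect to $\mathcal{M}$ and $k$: depth $d(w)$ = length of a shortest path from $w_d$ to $w$ along edges of any $R_i$ ($\infty$ if none); bound $b(w)=k-d(w)$. For $x,y$ with nonnegative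 bound, $x\succ y$ iff $b(x)>b(y)$ and $x\sim_{b(y)}y$. $\mathrm{Max}(W)=\{x\in W\mid b(x)\ge0$ and no $y\in W$ has $y\succ x\}$. For $0\le h\le k$, the least $h$-representative of $w\in W$ is $\ell_h(w)=\min_<\{v\in\mathrm{Max}(W)\mid v\sim_h w\}$. The $k$-contraction of $\mathcal{M}$ with respect to $<$ is $((W',R',V'),[w_d]_{b(w_d)})$ with $W'=\{[x]_{b(x)}\mid x\in\mathrm{Max}(W)\}$; $R'_i=\{([x]_{b(x)},[\ell_{b(x)-1}(y)]_{b(\ell_{b(x)-1}(y))})\mid x\in\mathrm{Max}(W),\ xR_iy,\ b(x)>0\}$; $V'(p)=\{[x]_{b(x)}\mid x\in\mathrm{Max}(W),\ x\in V(p)\}$. -}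

module Defs where

open import Level using (Level; 0ℓ; _⊔_) renaming (suc to lsuc)
open import Data.Nat using (ℕ; zero; suc; _≤_; _<_; _∸_)
open import Data.Fin using (Fin)
open import Data.Product using (Σ; ∃; _×_; _,_; proj₁; proj₂)
open import Data.Sum using (_⊎_)
open import Relation.Nullary using (¬_)
open import Relation.Binary using (Rel)
open import Relation.Binary.PropositionalEquality using (_≡_)

-- Models over m modality indices (ℐ = Fin m), atoms 𝒫 = ℕ, carrier W.
-- A *finite nonempty* model is one with carrier Fin n together with a
-- designated world (pointed model).

record Model {a ℓ : Level} (m : ℕ) (W : Set a) : Set (a ⊔ lsuc ℓ) where
  field
    R : Fin m → W → W → Set ℓ
    V : ℕ → W → Set ℓ

open Model public

-- k-bisimulation between pointed models (M , w) and (M' , w').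
-- Z h is the relation Z_h; only indices h ≤ k are constrained.

record KBisim {a ℓ a' ℓ' : Level} {m : ℕ} {W : Set a} {W' : Set a'} (k : ℕ)
              (M : Model {a} {ℓ} m W) (w : W) (M' : Model {a'} {ℓ'} m W') (w' : W')
              : Set (lsuc (ℓ ⊔ ℓ') ⊔ a ⊔ a') where
  field
    Z        : ℕ → W → W' → Set (ℓ ⊔ ℓ')
    nonempty : ∀ h → h ≤ k → Σ W λ u → Σ W' λ u' → Z h u u'
    mono     : ∀ h → h < k → ∀ u u' → Z (suc h) u u' → Z h u u'
    point    : Z k w w'
    atoms    : ∀ u u' → Z 0 u u' → ∀ p →
                 (V M p u → V M' p u') × (V M' p u' → V M p u)
    forth    : ∀ h → h < k → ∀ i u u' v → Z (suc h) u u' → R M i u v →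
                 Σ W' λ v' → R M' i u' v' × Z h v v'
    back     : ∀ h → h < k → ∀ i u u' v' → Z (suc h) u u' → R M' i u' v' →
                 Σ W λ v → R M i u v × Z h v v'

data Path {a ℓ : Level} {m : ℕ} {W : Set a} (M : Model {a} {ℓ} m W) : ℕ → W → W → Set (a ⊔ ℓ) where
  here : ∀ {u} → Path M 0 u u
  step : ∀ {h u v x} (i : Fin m) → R M i u v → Path M h v x → Path M (suc h) u x

module Contraction {m n : ℕ} (M : Model {0ℓ} {0ℓ} m (Fin n)) (wd : Fin n) (k : ℕ)
                   (_⊏_ : Rel (Fin n) 0ℓ) where

  _∼⟨_⟩_ : Fin n → ℕ → Fin n → Set₁
  x ∼⟨ h ⟩ y = KBisim h M x M y

  Depth : Fin n → ℕ → Set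
  Depth x h = Path M h wd x × (∀ h' → h' < h → ¬ Path M h' wd x)

  -- b(x) = c with b(x) ≥ 0, i.e. d(x) = h ≤ k and c = k - h
  Bound : Fin n → ℕ → Set
  Bound x c = Σ ℕ λ h → Depth x h × h ≤ k × c ≡ k ∸ h

  _≻_ : Fin n → Fin n → Set₁
  x ≻ y = Σ ℕ λ cx → Σ ℕ λ cy → Bound x cx × Bound y cy × cy < cx × x ∼⟨ cy ⟩ y

  MaxB : Fin n → ℕ → Set₁
  MaxB x c = Bound x c × (∀ y → ¬ (y ≻ x))

  -- z = ℓ_h(w): the ⊏-least v ∈ Max(W) with v ∼_h w  (z ∈ Max given separately)
  LeastRep : ℕ → Fin n → Fin n → Set₁
  LeastRep h w z = z ∼⟨ h ⟩ w ×
                   (∀ u c → MaxB u c → u ∼⟨ h ⟩ w → z ≡ u ⊎ z ⊏ u)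

  -- Representatives of worlds of W': x ∈ Max(W) together with its bound,
  -- standing for the class [x]_{b(x)}.
  W' : Set₁
  W' = Σ (Fin n) λ x → Σ ℕ λ c → MaxB x c

  rep : W' → Fin n
  rep = proj₁

  bnd : W' → ℕ
  bnd u = proj₁ (proj₂ u)

  -- [x]_{b(x)} = [y]_{b(y)}  as subsets of W
  SameClass : W' → W' → Set₁
  SameClass u v = ∀ w → (rep u ∼⟨ bnd u ⟩ w → rep v ∼⟨ bnd v ⟩ w)
                      × (rep v ∼⟨ bnd v ⟩ w → rep u ∼⟨ bnd u ⟩ w)

  -- R'_i and V' on representatives (both closed under SameClass)
  R' : Fin m → W' → W' → Set₁
  R' i u v = Σ (Fin n) λ x → Σ ℕ λ c → Σ (MaxB x c) λ mx →
             Σ (Fin n) λ y → R M i x y × 0 < c ×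
             (Σ (Fin n) λ z → Σ ℕ λ cz → Σ (MaxB z cz) λ mz →
                LeastRep (c ∸ 1) y z ×
                SameClass u (x , c , mx) × SameClass v (z , cz , mz))

  V' : ℕ → W' → Set₁
  V' p u = Σ (Fin n) λ x → Σ ℕ λ c → Σ (MaxB x c) λ mx →
           V M p x × SameClass u (x , c , mx)


  M' : Model {lsuc 0ℓ} {lsuc 0ℓ} m W'
  M' = record { R = R' ; V = V' }

  IsPoint : W' → Set₁
  IsPoint u = Σ ℕ λ c → Bound wd c ×
              (∀ w → (rep u ∼⟨ bnd u ⟩ w → wd ∼⟨ c ⟩ w) × (wd ∼⟨ c ⟩ w → rep u ∼⟨ bnd u ⟩ w))

  -- |W'| ≤ |W''| : an injective function from W' (= representatives modulo
  -- SameClass) into W'' = Fin n''.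
  CardLeW : ℕ → Set₁
  CardLeW n'' = Σ (W' → Fin n'') λ f → ∀ u v → (f u ≡ f v → SameClass u v) × (SameClass u v → f u ≡ f v)

  -- |R'_i| ≤ |R''_i| : an injective function from the set of pairs of
  -- classes in R'_i into the set of pairs in R''_i.
  CardLeR : ∀ {n''} → Model {0ℓ} {0ℓ} m (Fin n'') → Fin m → Set₁
  CardLeR {n''} M'' i =
    Σ (∀ u v → R' i u v → Fin n'' × Fin n'') λ g →
      (∀ u v r → R M'' i (proj₁ (g u v r)) (proj₂ (g u v r))) ×
      (∀ u v r u₂ v₂ r₂ → (g u v r ≡ g u₂ v₂ r₂ → SameClass u u₂ × SameClass v v₂)
                          × (SameClass u u₂ × SameClass v v₂ → g u v r ≡ g u₂ v₂ r₂))

{-# OPTIONS --safe #-}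
module Submission where

-- The relation linking w to [x]_{b(x)} at level h whenever h ≤ b(x) and x ∼_h w is a k-bisimulation
-- between M and its contraction: the forth step can land on ℓ_{b(x)−1}(y) because a maximal world
-- that is (b(x)−1)-bisimilar to y has bound at least b(x)−1. For minimality, a world x at depth d is
-- reached from w_d by a path of length d, so every pointed model k-bisimilar to M has a world that
-- is b(x)-bisimilar to x. Sending [x] to the least such world is injective: if two maximal worlds are
-- bisimilar at their respective bounds to a common world, they are bisimilar at the smaller bound,
-- so by maximality the bounds agree and the classes coincide. An edge ([x],[z]) is sent to the image
-- of [x] paired with its least successor that is (b(x)−1)-bisimilar to z; this recovers [z] since
-- z is the least (b(x)−1)-representative of its (b(x)−1)-class. Excluded middle makes bisimilarity
-- and reachability decidable, so these least elements of finite sets exist.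

open import Defs
open import Level using (Level; 0ℓ; lift; lower) renaming (suc to lsuc)
open import Data.Nat using (ℕ; zero; suc; pred; _∸_; _⊓_; _≤_; _<_; z≤n; s≤s; _≤?_)
open import Data.Nat.Properties
open import Data.Nat.Induction using (<-rec)
open import Data.Fin using (Fin) renaming (_<_ to _<ᶠ_)
open import Data.Fin.Properties using () renaming (<-isStrictTotalOrder to <ᶠ-isStrictTotalOrder)
open import Data.Product using (Σ; ∃; ∃₂; _×_; _,_; proj₁; proj₂; swap)
open import Data.Sum using (_⊎_; inj₁; inj₂; [_,_])
open import Data.Empty using (⊥-elim)
open import Data.List using (List; []; _∷_; allFin)
open import Data.List.Relation.Unary.Any using (here; there)
open import Data.List.Membership.Propositional using (_∈_)
open import Data.List.Membership.Propositional.Properties using (∈-allFin)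
open import Relation.Nullary using (¬_; yes; no)
open import Relation.Nullary.Decidable using (map′)
open import Relation.Unary using (Pred; Decidable)
open import Relation.Binary using (Rel; IsStrictTotalOrder; tri<; tri≈; tri>)
open import Relation.Binary.PropositionalEquality using (_≡_; refl; sym; trans; subst; cong; cong₂)
open import Axiom.ExcludedMiddle using (ExcludedMiddle)

private
  variable
    a ℓ a′ ℓ′ : Level
    m K h j : ℕ
    W W′ : Set a

module _ {M : Model {a} {ℓ} m W} {N : Model {a′} {ℓ′} m W′} where

  module _ {w : W} {w′ : W′} (B : KBisim K M w N w′) where
    open KBisim B

    Z-≤ : ∀ {u u′} → h ≤ j → j ≤ K → Z j u u′ → Z h u u′
    Z-≤ {j = zero} z≤n _ z = z
    Z-≤ {h = h} {j = suc j} h≤1+j 1+j≤K z with m≤n⇒m<n∨m≡n h≤1+j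
    ... | inj₁ h<1+j = Z-≤ (≤-pred h<1+j) (<⇒≤ 1+j≤K) (mono j 1+j≤K _ _ z)
    ... | inj₂ refl = z

    Z⇒bisim : ∀ {u u′} → j ≤ K → Z j u u′ → KBisim j M u N u′
    Z⇒bisim j≤K z = record
      { Z        = Z
      ; nonempty = λ h h≤j → _ , _ , Z-≤ h≤j j≤K z
      ; mono     = λ h h<j → mono h (<-≤-trans h<j j≤K)
      ; point    = z
      ; atoms    = atoms
      ; forth    = λ h h<j → forth h (<-≤-trans h<j j≤K)
      ; back     = λ h h<j → back h (<-≤-trans h<j j≤K)
      }

  module _ {w : W} {w′ : W′} where

    bisim-≤ : j ≤ K → KBisim K M w N w′ → KBisim j M w N w′
    bisim-≤ j≤K B = Z⇒bisim B j≤K (Z-≤ B j≤K ≤-refl (KBisim.point B))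

    bisim-sym : KBisim K M w N w′ → KBisim K N w′ M w
    bisim-sym B = record
      { Z        = λ h u′ u → Z h u u′
      ; nonempty = λ h h≤K → let (u , u′ , z) = nonempty h h≤K in u′ , u , z
      ; mono     = λ h h<K u′ u → mono h h<K u u′
      ; point    = point
      ; atoms    = λ u′ u z p → swap (atoms u u′ z p)
      ; forth    = λ h h<K i u′ u v′ → back h h<K i u u′ v′
      ; back     = λ h h<K i u′ u v → forth h h<K i u u′ v
      }
      where open KBisim B

    bisim-atoms : KBisim K M w N w′ → ∀ p → (V M p w → V N p w′) × (V N p w′ → V M p w)
    bisim-atoms B = KBisim.atoms B _ _ (Z-≤ B z≤n ≤-refl (KBisim.point B))

    bisim-forth : KBisim (suc h) M w N w′ → ∀ {i v} → R M i w v →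
                  ∃ λ v′ → R N i w′ v′ × KBisim h M v N v′
    bisim-forth {h} B {i} {v} w→v =
      let (v′ , w′→v′ , z) = KBisim.forth B h ≤-refl i w w′ v (KBisim.point B) w→v
      in v′ , w′→v′ , Z⇒bisim B (n≤1+n h) z

    bisim-back : KBisim (suc h) M w N w′ → ∀ {i v′} → R N i w′ v′ →
                 ∃ λ v → R M i w v × KBisim h M v N v′
    bisim-back {h} B {i} {v′} w′→v′ =
      let (v , w→v , z) = KBisim.back B h ≤-refl i w w′ v′ (KBisim.point B) w′→v′
      in v , w→v , Z⇒bisim B (n≤1+n h) z

  bisim-path : ∀ {w x w′} → KBisim K M w N w′ → Path M j w x → j ≤ K →
               ∃ λ x′ → KBisim (K ∸ j) M x N x′
  bisim-path B here _ = _ , B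
  bisim-path {K = suc K} B (step i w→v v⇝x) (s≤s j≤K) =
    let (_ , _ , B′) = bisim-forth B w→v in bisim-path B′ v⇝x j≤K

module _ {A B C : Set} {MA : Model {0ℓ} {0ℓ} m A} {MB : Model {0ℓ} {0ℓ} m B}
         {MC : Model {0ℓ} {0ℓ} m C} {a : A} {b : B} {c : C} where

  bisim-trans : KBisim K MA a MB b → KBisim K MB b MC c → KBisim K MA a MC c
  bisim-trans B₁ B₂ = record
    { Z        = λ h x z → ∃ λ y → Z₁ h x y × Z₂ h y z
    ; nonempty = λ h h≤K → a , c , b , Z-≤ B₁ h≤K ≤-refl point₁ , Z-≤ B₂ h≤K ≤-refl point₂
    ; mono     = λ h h<K x z (y , p , q) → y , mono₁ h h<K x y p , mono₂ h h<K y z q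
    ; point    = b , point₁ , point₂
    ; atoms    = λ x z (y , p , q) prop →
        let (f₁ , g₁) = atoms₁ x y p prop ; (f₂ , g₂) = atoms₂ y z q prop
        in (λ t → f₂ (f₁ t)) , (λ t → g₁ (g₂ t))
    ; forth    = λ h h<K i x z v (y , p , q) x→v →
        let (vy , y→vy , p′) = forth₁ h h<K i x y v p x→v
            (vz , z→vz , q′) = forth₂ h h<K i y z vy q y→vy
        in vz , z→vz , vy , p′ , q′
    ; back     = λ h h<K i x z vz (y , p , q) z→vz →
        let (vy , y→vy , q′) = back₂ h h<K i y z vz q z→vz
            (vx , x→vx , p′) = back₁ h h<K i x y vy p y→vy
        in vx , x→vx , vy , p′ , q′
    }
    where
      open KBisim B₁ renaming (Z to Z₁; mono to mono₁; point to point₁; atoms to atoms₁;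
                               forth to forth₁; back to back₁)
      open KBisim B₂ renaming (Z to Z₂; mono to mono₂; point to point₂; atoms to atoms₂;
                               forth to forth₂; back to back₂)

bisim-refl : {M : Model {0ℓ} {0ℓ} m W} {w : W} → KBisim K M w M w
bisim-refl {w = w} = record
  { Z        = λ _ → _≡_
  ; nonempty = λ _ _ → w , w , refl
  ; mono     = λ _ _ _ _ eq → eq
  ; point    = refl
  ; atoms    = λ { _ _ refl p → (λ t → t) , (λ t → t) }
  ; forth    = λ { _ _ _ _ _ v refl w→v → v , w→v , refl }
  ; back     = λ { _ _ _ _ _ v refl w→v → v , w→v , refl }
  }

Path-snoc : {M : Model {a} {ℓ} m W} {u x y : W} {i : Fin m} → Path M h u x → R M i x y → Path M (suc h) u y
Path-snoc here x→y = step _ x→y here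
Path-snoc (step i u→v v⇝x) x→y = step i u→v (Path-snoc v⇝x x→y)

IsLeast : ∀ {p} {A : Set a} → Rel A ℓ → Pred A p → A → Set _
IsLeast _<_ P x = P x × ∀ {y} → P y → x ≡ y ⊎ x < y

module _ {n p} {_<_ : Rel (Fin n) ℓ} (sto : IsStrictTotalOrder _≡_ _<_) {P : Pred (Fin n) p} where
  open IsStrictTotalOrder sto using (compare; asym) renaming (trans to <-trans′)

  private
    LeastIn : List (Fin n) → Fin n → Set _
    LeastIn xs x = P x × ∀ {y} → y ∈ xs → P y → x ≡ y ⊎ x < y

    least-cons : ∀ {x y xs} → P x → LeastIn xs y → ∃ (LeastIn (x ∷ xs))
    least-cons {x} {y} px (py , y≤) with compare x y
    ... | tri< x<y _ _ = x , px , λ where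
      (here refl) _ → inj₁ refl
      (there z∈xs) pz → inj₂ ([ (λ { refl → x<y }) , <-trans′ x<y ] (y≤ z∈xs pz))
    ... | tri≈ _ refl _ = y , py , λ where
      (here refl) _ → inj₁ refl
      (there z∈xs) pz → y≤ z∈xs pz
    ... | tri> _ _ y<x = y , py , λ where
      (here refl) _ → inj₂ y<x
      (there z∈xs) pz → y≤ z∈xs pz

    least-in : Decidable P → ∀ xs → (∀ {y} → y ∈ xs → ¬ P y) ⊎ ∃ (LeastIn xs)
    least-in P? [] = inj₁ λ ()
    least-in P? (x ∷ xs) with P? x | least-in P? xs
    ... | yes px | inj₁ none = inj₂ (x , px , λ where
      (here refl) _ → inj₁ refl
      (there y∈xs) py → ⊥-elim (none y∈xs py))
    ... | yes px | inj₂ (_ , least) = inj₂ (least-cons px least)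
    ... | no ¬px | inj₁ none = inj₁ λ where
      (here refl) → ¬px
      (there y∈xs) → none y∈xs
    ... | no ¬px | inj₂ (y , py , y≤) = inj₂ (y , py , λ where
      (here refl) px → ⊥-elim (¬px px)
      (there z∈xs) → y≤ z∈xs)

  least-exists : Decidable P → ∃ P → ∃ (IsLeast _<_ P)
  least-exists P? (x , px) with least-in P? (allFin n)
  ... | inj₁ none = ⊥-elim (none (∈-allFin x) px)
  ... | inj₂ (y , py , y≤) = y , py , λ {z} → y≤ (∈-allFin z)

  least-unique : ∀ {q} {Q : Pred (Fin n) q} {x y} →
                 IsLeast _<_ P x → IsLeast _<_ Q y → P y → Q x → x ≡ y
  least-unique (_ , x≤) (_ , y≤) py qx with x≤ py | y≤ qx
  ... | inj₁ x≡y | _ = x≡y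
  ... | inj₂ _ | inj₁ y≡x = sym y≡x
  ... | inj₂ x<y | inj₂ y<x = ⊥-elim (asym x<y y<x)

module ContractionProperties (em : ExcludedMiddle (lsuc 0ℓ)) {m n : ℕ}
         (M : Model {0ℓ} {0ℓ} m (Fin n)) (wd : Fin n) (k : ℕ)
         (_⊏_ : Rel (Fin n) 0ℓ) (⊏-sto : IsStrictTotalOrder _≡_ _⊏_) where
  open Contraction M wd k _⊏_

  private
    variable
      c c′ cx cy cz : ℕ
      i : Fin m
      w x y z : Fin n
      u : W'

    em₀ : ExcludedMiddle 0ℓ
    em₀ = map′ lower lift em

  depth-unique : Depth x h → Depth x j → h ≡ j
  depth-unique {h = h} {j = j} (p , p-shortest) (q , q-shortest) with <-cmp h j
  ... | tri< h<j _ _ = ⊥-elim (q-shortest h h<j p)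
  ... | tri≈ _ h≡j _ = h≡j
  ... | tri> _ _ j<h = ⊥-elim (p-shortest j j<h q)

  bound-unique : Bound x c → Bound x c′ → c ≡ c′
  bound-unique (h , D , _ , refl) (j , D′ , _ , refl) = cong (k ∸_) (depth-unique D D′)

  bound≤k : Bound x c → c ≤ k
  bound≤k (h , _ , _ , refl) = m∸n≤m k h

  bound-wd : Bound wd k
  bound-wd = 0 , (here , λ _ ()) , z≤n , refl

  shortest-path : Path M j wd y → ∃ λ h → Depth y h × h ≤ j
  shortest-path {y = y} = <-rec Shorten shorten _
    where
      Shorten : ℕ → Set
      Shorten j = Path M j wd y → ∃ λ h → Depth y h × h ≤ j

      shorten : ∀ j → (∀ {h} → h < j → Shorten h) → Shorten j
      shorten j rec p with em₀ {∃ λ h → h < j × Path M h wd y}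
      ... | yes (h , h<j , q) = let (d , D , d≤h) = rec h<j q in d , D , ≤-trans d≤h (<⇒≤ h<j)
      ... | no ¬shorter = j , (p , λ h h<j q → ¬shorter (h , h<j , q)) , ≤-refl

  bound-step : Bound x (suc c) → R M i x y → ∃ λ cy → Bound y cy × c ≤ cy
  bound-step {c = c} (h , (wd⇝x , _) , _ , 1+c≡k∸h) x→y =
    let (d , D , d≤1+h) = shortest-path (Path-snoc wd⇝x x→y)
        h<k = m∸n≢0⇒n<m (λ k∸h≡0 → 1+n≢0 (trans 1+c≡k∸h k∸h≡0))
        c≡k∸[1+h] = trans (cong pred 1+c≡k∸h) (pred[m∸n]≡m∸[1+n] k h)
    in k ∸ d , (d , D , ≤-trans d≤1+h h<k , refl) ,
       ≤-trans (≤-reflexive c≡k∸[1+h]) (∸-monoʳ-≤ k d≤1+h)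

  maxB-wd : MaxB wd k
  maxB-wd = bound-wd , λ { _ (cy , _ , By , Bwd , k<cy , _) →
    <⇒≱ (subst (_< cy) (bound-unique Bwd bound-wd) k<cy) (bound≤k By) }

  MaxAbove : Fin n → ℕ → Set₁
  MaxAbove y c = ∃₂ λ z cz → MaxB z cz × z ∼⟨ c ⟩ y

  max-above : Bound y c → MaxAbove y c
  max-above {c = c} = <-rec Climb climb (k ∸ c) refl
    where
      Climb : ℕ → Set₁
      Climb g = ∀ {y c} → k ∸ c ≡ g → Bound y c → MaxAbove y c

      climb : ∀ g → (∀ {g′} → g′ < g → Climb g′) → Climb g
      climb _ rec {y} {c} refl By with em {∃ λ y′ → y′ ≻ y}
      ... | no ¬dominated = y , c , (By , λ y′ y′≻y → ¬dominated (y′ , y′≻y)) , bisim-refl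
      ... | yes (y′ , c′ , c″ , By′ , By″ , c″<c′ , y′∼y) with bound-unique By″ By
      ... | refl =
        let (z , cz , mz , z∼y′) = rec (∸-monoʳ-< c″<c′ (bound≤k By′)) refl By′
        in z , cz , mz , bisim-trans (bisim-≤ (<⇒≤ c″<c′) z∼y′) y′∼y

  ≤-maxBound : MaxB z cz → Bound y cy → j ≤ cy → z ∼⟨ j ⟩ y → j ≤ cz
  ≤-maxBound {cz = cz} {j = j} (Bz , z-max) By j≤cy z∼y with j ≤? cz
  ... | yes j≤cz = j≤cz
  ... | no j≰cz =
    let cz<j = ≰⇒> j≰cz
    in ⊥-elim (z-max _ (_ , _ , By , Bz , <-≤-trans cz<j j≤cy , bisim-sym (bisim-≤ (<⇒≤ cz<j) z∼y)))

  maximal-bisim⇒bound-≡ : MaxB x cx → MaxB y cy → x ∼⟨ cx ⊓ cy ⟩ y → cx ≡ cy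
  maximal-bisim⇒bound-≡ {cx = cx} {cy = cy} (Bx , x-max) (By , y-max) x∼y with <-cmp cx cy
  ... | tri< cx<cy _ _ =
    let x∼ₓy = subst (λ j → _ ∼⟨ j ⟩ _) (m≤n⇒m⊓n≡m (<⇒≤ cx<cy)) x∼y
    in ⊥-elim (x-max _ (_ , _ , By , Bx , cx<cy , bisim-sym x∼ₓy))
  ... | tri≈ _ cx≡cy _ = cx≡cy
  ... | tri> _ _ cy<cx =
    let x∼ᵧy = subst (λ j → _ ∼⟨ j ⟩ _) (m≥n⇒m⊓n≡n (<⇒≤ cy<cx)) x∼y
    in ⊥-elim (y-max _ (_ , _ , Bx , By , cy<cx , x∼ᵧy))

  isMax : (u : W') → MaxB (rep u) (bnd u)
  isMax (_ , _ , mx) = mx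

  SameClass-refl : (u : W') → SameClass u u
  SameClass-refl _ _ = (λ t → t) , (λ t → t)

  SameClass-sym : ∀ u v → SameClass u v → SameClass v u
  SameClass-sym _ _ u≈v w = swap (u≈v w)

  SameClass-trans : ∀ u v x → SameClass u v → SameClass v x → SameClass u x
  SameClass-trans _ _ _ u≈v v≈x w =
    (λ t → proj₁ (v≈x w) (proj₁ (u≈v w) t)) , (λ t → proj₂ (u≈v w) (proj₂ (v≈x w) t))

  bisim⇒SameClass : ∀ u v → bnd u ≡ bnd v → rep u ∼⟨ bnd u ⟩ rep v → SameClass u v
  bisim⇒SameClass (_ , c , _) (_ , .c , _) refl u∼v _ =
    (λ u∼w → bisim-trans (bisim-sym u∼v) u∼w) , (λ v∼w → bisim-trans u∼v v∼w)

  maximal-bisim⇒SameClass : ∀ u v → rep u ∼⟨ bnd u ⊓ bnd v ⟩ rep v → SameClass u v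
  maximal-bisim⇒SameClass u v u∼v =
    let bu≡bv = maximal-bisim⇒bound-≡ (isMax u) (isMax v) u∼v
    in bisim⇒SameClass u v bu≡bv (subst (λ j → rep u ∼⟨ j ⟩ rep v) (m≤n⇒m⊓n≡m (≤-reflexive bu≡bv)) u∼v)

  SameClass⇒bisim : ∀ u v → SameClass u v → bnd u ≡ bnd v × rep u ∼⟨ bnd u ⟩ rep v
  SameClass⇒bisim u v u≈v =
    let u∼v = proj₂ (u≈v (rep v)) bisim-refl
        bu≡bv = maximal-bisim⇒bound-≡ (isMax u) (isMax v) (bisim-≤ (m⊓n≤m _ _) u∼v)
    in bu≡bv , u∼v

  rep-≡⇒SameClass : ∀ u v → rep u ≡ rep v → SameClass u v
  rep-≡⇒SameClass u@(_ , _ , mx) v@(_ , _ , my) refl with bound-unique (proj₁ mx) (proj₁ my)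
  ... | refl = bisim⇒SameClass u v refl bisim-refl

  IsRep : ℕ → Fin n → Fin n → Set₁
  IsRep j w z = ∃ (MaxB z) × z ∼⟨ j ⟩ w

  LeastRep⇒IsLeast : MaxB z cz → LeastRep j w z → IsLeast _⊏_ (IsRep j w) z
  LeastRep⇒IsLeast mz (z∼w , z-least) = ((_ , mz) , z∼w) , λ ((c , mu) , u∼w) → z-least _ c mu u∼w

  leastRep-exists : Bound y cy → j ≤ cy → ∃₂ λ z cz → MaxB z cz × LeastRep j y z
  leastRep-exists {y = y} {j = j} By j≤cy =
    let (z₀ , cz₀ , mz₀ , z₀∼y) = max-above By
        (z , ((cz , mz) , z∼y) , z-least) =
          least-exists ⊏-sto {P = IsRep j y} (λ _ → em) (z₀ , (cz₀ , mz₀) , bisim-≤ j≤cy z₀∼y)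
    in z , cz , mz , z∼y , λ u c mu u∼y → z-least ((c , mu) , u∼y)

  LeastRep-resp : w ∼⟨ j ⟩ x → LeastRep j w z → LeastRep j x z
  LeastRep-resp w∼x (z∼w , z-least) =
    bisim-trans z∼w w∼x , λ u c mu u∼x → z-least u c mu (bisim-trans u∼x (bisim-sym w∼x))

  LeastRep-unique : MaxB z cz → MaxB x cx → LeastRep j w z → LeastRep j w x → z ≡ x
  LeastRep-unique mz mx z-least x-least =
    least-unique ⊏-sto (LeastRep⇒IsLeast mz z-least) (LeastRep⇒IsLeast mx x-least)
                 ((_ , mx) , proj₁ x-least) ((_ , mz) , proj₁ z-least)

  w'd : W'
  w'd = wd , k , maxB-wd

  w'd-isPoint : IsPoint w'd
  w'd-isPoint = k , bound-wd , λ _ → (λ t → t) , (λ t → t)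

  record R'Witness (i : Fin m) (u v : W') : Set₁ where
    field
      deg           : ℕ
      src-bound     : bnd u ≡ suc deg
      deg≤tgt-bound : deg ≤ bnd v
      src tgt       : Fin n
      edge          : R M i src tgt
      src∼          : rep u ∼⟨ suc deg ⟩ src
      tgt∼          : rep v ∼⟨ deg ⟩ tgt
      tgt-rep       : W'
      tgt-rep-least : LeastRep deg (rep v) (rep tgt-rep)
      tgt-class     : SameClass v tgt-rep

  R'⇒witness : ∀ u v → R' i u v → R'Witness i u v
  R'⇒witness u v
    (x , _ , mx , y , x→y , s≤s {n = deg} z≤n , z , cz , mz , z-least@(z∼y , _) , u≈x , v≈z) = record
      { deg           = deg
      ; src-bound     = bu≡1+deg
      ; deg≤tgt-bound = deg≤bv
      ; src           = x
      ; tgt           = y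
      ; edge          = x→y
      ; src∼          = subst (λ j → rep u ∼⟨ j ⟩ x) bu≡1+deg u∼x
      ; tgt∼          = v∼y
      ; tgt-rep       = z′
      ; tgt-rep-least = LeastRep-resp (bisim-sym v∼y) z-least
      ; tgt-class     = v≈z
      }
    where
      x′ z′ : W'
      x′ = x , suc deg , mx
      z′ = z , cz , mz
      bu≡1+deg : bnd u ≡ suc deg
      bu≡1+deg = proj₁ (SameClass⇒bisim u x′ u≈x)
      u∼x : rep u ∼⟨ bnd u ⟩ x
      u∼x = proj₂ (SameClass⇒bisim u x′ u≈x)
      deg≤bv : deg ≤ bnd v
      deg≤bv =
        let (cy , By , deg≤cy) = bound-step (proj₁ mx) x→y
        in subst (deg ≤_) (sym (proj₁ (SameClass⇒bisim v z′ v≈z))) (≤-maxBound mz By deg≤cy z∼y)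
      v∼y : rep v ∼⟨ deg ⟩ y
      v∼y = bisim-trans (bisim-≤ deg≤bv (proj₂ (SameClass⇒bisim v z′ v≈z))) z∼y

  V'⇔V : ∀ {p} u → (V' p u → V M p (rep u)) × (V M p (rep u) → V' p u)
  V'⇔V {p} u@(x , c , mx) =
    (λ (y , cy , my , y∈p , u≈y) →
       proj₂ (bisim-atoms (proj₂ (SameClass⇒bisim u (y , cy , my) u≈y)) p) y∈p) ,
    (λ x∈p → x , c , mx , x∈p , SameClass-refl u)

  Z' : ℕ → Fin n → W' → Set₁
  Z' h w u = rep u ∼⟨ h ⟩ w × h ≤ bnd u

  contraction-forth : ∀ {v} → Z' (suc h) w u → R M i w v → Σ W' λ v′ → R' i u v′ × Z' h v v′
  contraction-forth {u = u@(x , suc c , mx)} (x∼w , s≤s h≤c) w→v =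
    let (y , x→y , y∼v) = bisim-back x∼w w→v
        (cy , By , c≤cy) = bound-step (proj₁ mx) x→y
        (z , cz , mz , z-least@(z∼y , _)) = leastRep-exists By c≤cy
        z′ = z , cz , mz
    in z′ ,
       (x , suc c , mx , y , x→y , s≤s z≤n , z , cz , mz , z-least , SameClass-refl u , SameClass-refl z′) ,
       bisim-trans (bisim-≤ h≤c z∼y) y∼v , ≤-trans h≤c (≤-maxBound mz By c≤cy z∼y)

  contraction-back : ∀ {v′} → Z' (suc h) w u → R' i u v′ → Σ (Fin n) λ v → R M i w v × Z' h v v′
  contraction-back {h = h} {w = w} {u = u} {v′ = v′} (u∼w , 1+h≤bu) u→v′ =
    let (v , w→v , tgt∼v) = bisim-forth src∼w edge
    in v , w→v , bisim-trans (bisim-≤ h≤deg tgt∼) tgt∼v , ≤-trans h≤deg deg≤tgt-bound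
    where
      open R'Witness (R'⇒witness u v′ u→v′)
      h≤deg : h ≤ deg
      h≤deg = ≤-pred (subst (suc h ≤_) src-bound 1+h≤bu)
      src∼w : src ∼⟨ suc h ⟩ w
      src∼w = bisim-trans (bisim-sym (bisim-≤ (s≤s h≤deg) src∼)) u∼w

  contraction-bisim : KBisim k M wd M' w'd
  contraction-bisim = record
    { Z        = Z'
    ; nonempty = λ _ h≤k → wd , w'd , bisim-refl , h≤k
    ; mono     = λ h _ _ _ (u∼w , 1+h≤bu) → bisim-≤ (n≤1+n h) u∼w , <⇒≤ 1+h≤bu
    ; point    = bisim-refl , ≤-refl
    ; atoms    = λ w u (u∼w , _) p →
        let (u→w , w→u) = bisim-atoms u∼w p
        in (λ w∈p → proj₂ (V'⇔V u) (w→u w∈p)) , (λ u∈p → u→w (proj₁ (V'⇔V u) u∈p))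
    ; forth    = λ _ _ _ _ u _ → contraction-forth {u = u}
    ; back     = λ _ _ _ _ u v′ → contraction-back {u = u} {v′ = v′}
    }

  R'-target-determined : ∀ {i₂} u v u₂ v₂ → R' i u v → R' i₂ u₂ v₂ →
                         bnd u ≡ bnd u₂ → rep v ∼⟨ bnd u ∸ 1 ⟩ rep v₂ → SameClass v v₂
  R'-target-determined u v u₂ v₂ u→v u₂→v₂ bu≡bu₂ v∼v₂ =
    SameClass-trans v tgt-rep v₂ tgt-class
      (SameClass-trans tgt-rep W₂.tgt-rep v₂ (rep-≡⇒SameClass tgt-rep W₂.tgt-rep same-rep)
                       (SameClass-sym v₂ W₂.tgt-rep W₂.tgt-class))
    where
      open R'Witness (R'⇒witness u v u→v)
      module W₂ = R'Witness (R'⇒witness u₂ v₂ u₂→v₂)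
      deg₂≡deg : W₂.deg ≡ deg
      deg₂≡deg = suc-injective (trans (sym W₂.src-bound) (trans (sym bu≡bu₂) src-bound))
      same-rep : rep tgt-rep ≡ rep W₂.tgt-rep
      same-rep = LeastRep-unique (isMax tgt-rep) (isMax W₂.tgt-rep)
        (LeastRep-resp (subst (λ j → rep v ∼⟨ j ⟩ rep v₂) (cong (_∸ 1) src-bound) v∼v₂) tgt-rep-least)
        (subst (λ j → LeastRep j (rep v₂) (rep W₂.tgt-rep)) deg₂≡deg W₂.tgt-rep-least)

  module Minimality {n″} (M″ : Model {0ℓ} {0ℓ} m (Fin n″)) (w″d : Fin n″)
                    (B″ : KBisim k M wd M″ w″d) where

    Image : W' → Fin n″ → Set₁
    Image u t = KBisim (bnd u) M (rep u) M″ t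

    image-exists : ∀ u → ∃ (Image u)
    image-exists (_ , _ , (_ , (wd⇝x , _) , h≤k , refl) , _) = bisim-path B″ wd⇝x h≤k

    Image-resp : ∀ u v {t} → SameClass u v → Image u t → Image v t
    Image-resp u v u≈v u∼t =
      let (bu≡bv , u∼v) = SameClass⇒bisim u v u≈v
      in subst (λ j → KBisim j M (rep v) M″ _) bu≡bv (bisim-trans (bisim-sym u∼v) u∼t)

    least-image : ∀ u → ∃ (IsLeast _<ᶠ_ (Image u))
    least-image u = least-exists <ᶠ-isStrictTotalOrder (λ _ → em) (image-exists u)

    embed : W' → Fin n″
    embed u = proj₁ (least-image u)

    embed-image : ∀ u → Image u (embed u)
    embed-image u = proj₁ (proj₂ (least-image u))

    embed-resp : ∀ u v → SameClass u v → embed u ≡ embed v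
    embed-resp u v u≈v =
      least-unique <ᶠ-isStrictTotalOrder (proj₂ (least-image u)) (proj₂ (least-image v))
        (Image-resp v u (SameClass-sym u v u≈v) (embed-image v)) (Image-resp u v u≈v (embed-image u))

    embed-injective : ∀ u v → embed u ≡ embed v → SameClass u v
    embed-injective u v eq = maximal-bisim⇒SameClass u v
      (bisim-trans (bisim-≤ (m⊓n≤m _ _) (embed-image u))
                   (bisim-sym (bisim-≤ (m⊓n≤n _ _) (subst (Image v) (sym eq) (embed-image v)))))

    card-W : CardLeW n″
    card-W = embed , λ u v → embed-injective u v , embed-resp u v

    module _ (i : Fin m) where

      EdgeImage : W' → W' → Fin n″ → Set₁
      EdgeImage u v t = R M″ i (embed u) t × KBisim (bnd u ∸ 1) M (rep v) M″ t

      edgeImage-exists : ∀ u v → R' i u v → ∃ (EdgeImage u v)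
      edgeImage-exists u v u→v =
        let (t , embed-u→t , tgt∼t) = bisim-forth src∼embed-u edge
        in t , embed-u→t ,
           subst (λ j → KBisim (j ∸ 1) M (rep v) M″ t) (sym src-bound) (bisim-trans tgt∼ tgt∼t)
        where
          open R'Witness (R'⇒witness u v u→v)
          src∼embed-u : KBisim (suc deg) M src M″ (embed u)
          src∼embed-u =
            bisim-trans (bisim-sym src∼)
                        (subst (λ j → KBisim j M (rep u) M″ (embed u)) src-bound (embed-image u))

      EdgeImage-resp : ∀ u v u₂ v₂ {t} → R' i u v → SameClass u u₂ → SameClass v v₂ →
                       EdgeImage u v t → EdgeImage u₂ v₂ t
      EdgeImage-resp u v u₂ v₂ {t} u→v u≈u₂ v≈v₂ (embed-u→t , v∼t) =
        subst (λ s → R M″ i s t) (embed-resp u u₂ u≈u₂) embed-u→t ,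
        subst (λ j → KBisim (j ∸ 1) M (rep v₂) M″ t) (proj₁ (SameClass⇒bisim u u₂ u≈u₂))
              (bisim-trans (bisim-sym (bisim-≤ bu∸1≤bv (proj₂ (SameClass⇒bisim v v₂ v≈v₂)))) v∼t)
        where
          open R'Witness (R'⇒witness u v u→v)
          bu∸1≤bv : bnd u ∸ 1 ≤ bnd v
          bu∸1≤bv = subst (_≤ bnd v) (sym (cong (_∸ 1) src-bound)) deg≤tgt-bound

      least-edgeImage : ∀ u v → R' i u v → ∃ (IsLeast _<ᶠ_ (EdgeImage u v))
      least-edgeImage u v u→v = least-exists <ᶠ-isStrictTotalOrder (λ _ → em) (edgeImage-exists u v u→v)

      embed-edge : ∀ u v → R' i u v → Fin n″ × Fin n″
      embed-edge u v u→v = embed u , proj₁ (least-edgeImage u v u→v)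

      embed-edge-image : ∀ u v (u→v : R' i u v) → EdgeImage u v (proj₂ (embed-edge u v u→v))
      embed-edge-image u v u→v = proj₁ (proj₂ (least-edgeImage u v u→v))

      embed-edge-resp : ∀ u v u→v u₂ v₂ u₂→v₂ → SameClass u u₂ × SameClass v v₂ →
                        embed-edge u v u→v ≡ embed-edge u₂ v₂ u₂→v₂
      embed-edge-resp u v u→v u₂ v₂ u₂→v₂ (u≈u₂ , v≈v₂) =
        cong₂ _,_ (embed-resp u u₂ u≈u₂)
          (least-unique <ᶠ-isStrictTotalOrder
            (proj₂ (least-edgeImage u v u→v)) (proj₂ (least-edgeImage u₂ v₂ u₂→v₂))
            (EdgeImage-resp u₂ v₂ u v u₂→v₂ (SameClass-sym u u₂ u≈u₂) (SameClass-sym v v₂ v≈v₂)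
                            (embed-edge-image u₂ v₂ u₂→v₂))
            (EdgeImage-resp u v u₂ v₂ u→v u≈u₂ v≈v₂ (embed-edge-image u v u→v)))

      embed-edge-injective : ∀ u v u→v u₂ v₂ u₂→v₂ →
                             embed-edge u v u→v ≡ embed-edge u₂ v₂ u₂→v₂ →
                             SameClass u u₂ × SameClass v v₂
      embed-edge-injective u v u→v u₂ v₂ u₂→v₂ eq =
        u≈u₂ , R'-target-determined u v u₂ v₂ u→v u₂→v₂ bu≡bu₂ (bisim-trans v∼t (bisim-sym v₂∼t))
        where
          u≈u₂ : SameClass u u₂
          u≈u₂ = embed-injective u u₂ (cong proj₁ eq)
          bu≡bu₂ : bnd u ≡ bnd u₂
          bu≡bu₂ = proj₁ (SameClass⇒bisim u u₂ u≈u₂)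
          t : Fin n″
          t = proj₂ (embed-edge u v u→v)
          v∼t : KBisim (bnd u ∸ 1) M (rep v) M″ t
          v∼t = proj₂ (embed-edge-image u v u→v)
          v₂∼t : KBisim (bnd u ∸ 1) M (rep v₂) M″ t
          v₂∼t = subst (λ j → KBisim (j ∸ 1) M (rep v₂) M″ t) (sym bu≡bu₂)
                   (subst (KBisim _ M (rep v₂) M″) (sym (cong proj₂ eq))
                          (proj₂ (embed-edge-image u₂ v₂ u₂→v₂)))

      card-R : CardLeR M″ i
      card-R = embed-edge ,
               (λ u v u→v → proj₁ (embed-edge-image u v u→v)) ,
               λ u v u→v u₂ v₂ u₂→v₂ → embed-edge-injective u v u→v u₂ v₂ u₂→v₂ ,
                                       embed-edge-resp u v u→v u₂ v₂ u₂→v₂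

theorem5p6 : ExcludedMiddle (lsuc 0ℓ) →
    ∀ {m n : ℕ} (M : Model {0ℓ} {0ℓ} m (Fin n)) (wd : Fin n) (k : ℕ)
      (_⊏_ : Rel (Fin n) 0ℓ) → IsStrictTotalOrder _≡_ _⊏_ →
    (Σ (Contraction.W' M wd k _⊏_) λ w'd →
       Contraction.IsPoint M wd k _⊏_ w'd ×
       KBisim k M wd (Contraction.M' M wd k _⊏_) w'd)
    ×
    (∀ (n'' : ℕ) (M'' : Model {0ℓ} {0ℓ} m (Fin n'')) (w''d : Fin n'') →
       KBisim k M wd M'' w''d →
       Contraction.CardLeW M wd k _⊏_ n'' ×
       (∀ (i : Fin m) → Contraction.CardLeR M wd k _⊏_ M'' i))
theorem5p6 em M wd k _⊏_ ⊏-sto =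
  (w'd , w'd-isPoint , contraction-bisim) ,
  λ n″ M″ w″d B″ → let open Minimality M″ w″d B″ in card-W , card-R
  where open ContractionProperties em M wd k _⊏_ ⊏-sto
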